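{- Every quasi-cohesive set $Q\subseteq\omega$ has intrinsic density $0$.
   Context: An infinite set $C$ is cohesive if for every c.e. set $U$, either $C\cap U$ or $C\cap\overline{U}$ is finite. A set is quasi-cohesive if it is a finite union of cohesive sets. For $X\subseteq\omega$, $\rho_n(X)=|X\cap[0,n)|/n$; $X$ has intrinsic density $0$ if $\lim_n\rho_n(\pi(X))=0$ for every computable permutation $\pi$ of $\omega$. -}

module Defs where

open import Data.Nat using (ℕ; zero; suc; _+_; _*_; _≤_; _<_)
open import Data.Bool using (Bool; true; false)
open import Data.Fin using (Fin)
open import Data.Vec using (Vec; []; _∷_; lookup)
open import Data.List using (List)
open import Data.List.Relation.Unary.All using (All)
open import Data.List.Relation.Unary.Any using (Any)
open import Data.Product using (Σ; ∃; _×_; _,_)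
open import Data.Sum using (_⊎_)
open import Function.Bundles using (_↔_; Inverse)
open import Relation.Binary.PropositionalEquality using (_≡_)

Subset : Set
Subset = ℕ → Bool

_∈_ : ℕ → Subset → Set
x ∈ X = X x ≡ true

_∉_ : ℕ → Subset → Set
x ∉ X = X x ≡ false

data Code : ℕ → Set where
  zeroᶜ : ∀ {n} → Code n
  succᶜ : Code 1
  projᶜ : ∀ {n} → Fin n → Code n
  compᶜ : ∀ {m n} → Code m → Vec (Code n) m → Code n
  recᶜ  : ∀ {n} → Code n → Code (suc (suc n)) → Code (suc n)
  minᶜ  : ∀ {n} → Code (suc n) → Code n

mutual
  -- Eval c xs y : the partial function coded by c, on input xs,
  -- converges with output y.
  data Eval : ∀ {n} → Code n → Vec ℕ n → ℕ → Set where
    evZero : ∀ {n} {xs : Vec ℕ n} → Eval zeroᶜ xs 0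
    evSucc : ∀ {x} → Eval succᶜ (x ∷ []) (suc x)
    evProj : ∀ {n} {i : Fin n} {xs} → Eval (projᶜ i) xs (lookup xs i)
    evComp : ∀ {m n} {f : Code m} {gs : Vec (Code n) m} {xs ys y} →
             EvalAll gs xs ys → Eval f ys y → Eval (compᶜ f gs) xs y
    evRec0 : ∀ {n} {g : Code n} {h} {xs y} →
             Eval g xs y → Eval (recᶜ g h) (0 ∷ xs) y
    evRecS : ∀ {n} {g : Code n} {h} {k xs r y} →
             Eval (recᶜ g h) (k ∷ xs) r → Eval h (k ∷ r ∷ xs) y →
             Eval (recᶜ g h) (suc k ∷ xs) y
    evMin  : ∀ {n} {f : Code (suc n)} {xs y} →
             Eval f (y ∷ xs) 0 →
             ((z : ℕ) → z < y → Σ ℕ (λ w → Eval f (z ∷ xs) (suc w))) →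
             Eval (minᶜ f) xs y

  data EvalAll : ∀ {m n} → Vec (Code n) m → Vec ℕ n → Vec ℕ m → Set where
    []  : ∀ {n} {xs : Vec ℕ n} → EvalAll [] xs []
    _∷_ : ∀ {m n} {g : Code n} {gs : Vec (Code n) m} {xs y ys} →
          Eval g xs y → EvalAll gs xs ys → EvalAll (g ∷ gs) xs (y ∷ ys)

Computable : (ℕ → ℕ) → Set
Computable f = Σ (Code 1) (λ c → (x : ℕ) → Eval c (x ∷ []) (f x))

IsCE : Subset → Set
IsCE U = Σ (Code 1) (λ c → (x : ℕ) →
           (x ∈ U → ∃ (λ y → Eval c (x ∷ []) y)) ×
           (∃ (λ y → Eval c (x ∷ []) y) → x ∈ U))

Finite : Subset → Set
Finite X = ∃ λ b → (x : ℕ) → x ∈ X → x < b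

Infinite : Subset → Set
Infinite X = (b : ℕ) → ∃ λ x → b ≤ x × x ∈ X

_∩_ : Subset → Subset → Subset
(X ∩ Y) x = Data.Bool._∧_ (X x) (Y x)

complement : Subset → Subset
complement X x = Data.Bool.not (X x)

Cohesive : Subset → Set
Cohesive C = Infinite C ×
  ((U : Subset) → IsCE U → Finite (C ∩ U) ⊎ Finite (C ∩ complement U))

QuasiCohesive : Subset → Set
QuasiCohesive Q = Σ (List Subset) λ Cs →
  All Cohesive Cs ×
  ((x : ℕ) → (x ∈ Q → Any (λ C → x ∈ C) Cs) × (Any (λ C → x ∈ C) Cs → x ∈ Q))

count : Subset → ℕ → ℕ
count X zero = 0
count X (suc n) with X n
... | true  = suc (count X n)
... | false = count X n

image : ℕ ↔ ℕ → Subset → Subset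
image π X y = X (Inverse.from π y)

-- ρ_n(X) → 0 : for every k, eventually k · |X ∩ [0,n)| ≤ n, i.e. ρ_n(X) ≤ 1/k.
DensityZero : Subset → Set
DensityZero X = (k : ℕ) → ∃ λ N → (n : ℕ) → N ≤ n → k * count X n ≤ n

ComputablePerm : ℕ ↔ ℕ → Set
ComputablePerm π = Computable (Inverse.to π)

IntrinsicDensityZero : Subset → Set
IntrinsicDensityZero X = (π : ℕ ↔ ℕ) → ComputablePerm π → DensityZero (image π X)

-- Fix a computable permutation π and a modulus M = A + 1.  The sets
-- Slice A v = { y : v + y ≡ A (mod M) }, for v < M, cover ω, are computable
-- (we compute "mod M" with the cyclic predecessor on {0,…,A}), and each is
-- sparse: two of its elements are at least M apart, so it has upper
-- density at most 1/M.  Their preimages under π are c.e., so a cohesive set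
-- C is almost contained in one of them; hence π(C) is almost contained in
-- a slice and has upper density at most 1/M.  A union of m cohesive sets
-- then has upper density at most m/M under π, and choosing M = K·(m+1)
-- gives density below 1/K eventually.
module Submission where

open import Defs
open import Algebra.Properties.CommutativeSemigroup using (interchange)
open import Data.Bool using (Bool; true; false; _∨_; not)
open import Data.Bool.Properties using (∨-zeroʳ; not-involutive; T-≡)
open import Data.Empty using (⊥; ⊥-elim)
open import Data.Fin using () renaming (zero to fzero; suc to fsuc)
open import Data.List using (List; []; _∷_; length; map)
open import Data.List.Properties using (length-map)
open import Data.List.Relation.Unary.All as All using (All)
import Data.List.Relation.Unary.All.Properties as All
open import Data.List.Relation.Unary.Any using (Any; here; there)
import Data.List.Relation.Unary.Any.Properties as Any
open import Data.Nat
  using (ℕ; zero; suc; _+_; _*_; _∸_; _≤_; _<_; _<ᵇ_; _⊔_; z≤n; s≤s; NonZero; >-nonZero⁻¹)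
open import Data.Nat.GeneralisedArithmetic using (fold; iterate; fold-+; iterate-is-fold)
open import Data.Nat.Induction using (<-rec)
open import Data.Nat.Properties
open import Data.Product using (∃; _×_; _,_; proj₁; proj₂)
open import Data.Sum using (_⊎_; inj₁; inj₂)
open import Data.Vec using (Vec; []; _∷_)
open import Function.Base using (_∘_)
open import Function.Bundles using (_↔_; Inverse; Equivalence)
open import Relation.Binary.Definitions using (tri<; tri≈; tri>)
open import Relation.Binary.PropositionalEquality
open import Relation.Nullary using (yes; no)

false≢true : false ≡ true → ⊥
false≢true ()

mutual
  eval-deterministic : ∀ {n} {c : Code n} {xs y y′} →
                       Eval c xs y → Eval c xs y′ → y ≡ y′
  eval-deterministic evZero evZero = refl
  eval-deterministic evSucc evSucc = refl
  eval-deterministic evProj evProj = refl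
  eval-deterministic (evComp as f) (evComp as′ f′) with evalAll-deterministic as as′
  ... | refl = eval-deterministic f f′
  eval-deterministic (evRec0 g) (evRec0 g′) = eval-deterministic g g′
  eval-deterministic (evRecS r h) (evRecS r′ h′) with eval-deterministic r r′
  ... | refl = eval-deterministic h h′
  -- the search stops at the first zero, so a smaller output would be a
  -- nonzero value of the searched function that is also zero
  eval-deterministic {y = y} {y′} (evMin z below) (evMin z′ below′) with <-cmp y y′
  ... | tri≈ _ y≡y′ _ = y≡y′
  ... | tri< y<y′ _ _ with () ← eval-deterministic z (proj₂ (below′ y y<y′))
  eval-deterministic {y = y} {y′} (evMin z below) (evMin z′ below′)
    | tri> _ _ y′<y with () ← eval-deterministic z′ (proj₂ (below y′ y′<y))

  evalAll-deterministic : ∀ {m n} {gs : Vec (Code n) m} {xs ys ys′} →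
                          EvalAll gs xs ys → EvalAll gs xs ys′ → ys ≡ ys′
  evalAll-deterministic [] [] = refl
  evalAll-deterministic (e ∷ es) (e′ ∷ es′) =
    cong₂ _∷_ (eval-deterministic e e′) (evalAll-deterministic es es′)

constᶜ : ∀ {n} → ℕ → Code n
constᶜ zero    = zeroᶜ
constᶜ (suc a) = compᶜ succᶜ (constᶜ a ∷ [])

eval-const : ∀ {n} (a : ℕ) {xs : Vec ℕ n} → Eval (constᶜ a) xs a
eval-const zero    = evZero
eval-const (suc a) = evComp (eval-const a ∷ []) evSucc

computable-suc : Computable suc
computable-suc = succᶜ , λ _ → evSucc

computable-∘ : ∀ {g f : ℕ → ℕ} → Computable g → Computable f → Computable (g ∘ f)
computable-∘ {f = f} (cg , eg) (cf , ef) =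
  compᶜ cg (cf ∷ []) , λ x → evComp (ef x ∷ []) (eg (f x))

computable-+ : ∀ v → Computable (v +_)
computable-+ zero    = projᶜ fzero , λ _ → evProj
computable-+ (suc v) = computable-∘ computable-suc (computable-+ v)

computable-fold : ∀ {s : ℕ → ℕ} (a : ℕ) → Computable s → Computable (fold a s)
computable-fold {s} a (cs , es) = code , eval
  where
  code : Code 1
  code = recᶜ (constᶜ a) (compᶜ cs (projᶜ (fsuc fzero) ∷ []))
  eval : ∀ n → Eval code (n ∷ []) (fold a s n)
  eval zero    = evRec0 (eval-const a)
  eval (suc n) = evRecS (eval n) (evComp (evProj ∷ []) (es (fold a s n)))

isZero : ℕ → Bool
isZero zero    = true
isZero (suc _) = false

isZero-sound : ∀ n → isZero n ≡ true → n ≡ 0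
isZero-sound zero _ = refl

isZero-pos : ∀ {n} → 0 < n → isZero n ≡ false
isZero-pos (s≤s _) = refl

Zeros : (ℕ → ℕ) → Subset
Zeros f x = isZero (f x)

-- The zero set of a computable function is c.e.: search for any y with
-- f x ≡ 0; the search halts exactly when f x ≡ 0.
zeros-ce : ∀ {f : ℕ → ℕ} → Computable f → IsCE (Zeros f)
zeros-ce {f} (c , ec) = search , λ x → halts x , halted x
  where
  search : Code 1
  search = minᶜ (compᶜ c (projᶜ (fsuc fzero) ∷ []))
  halts : ∀ x → x ∈ Zeros f → ∃ λ y → Eval search (x ∷ []) y
  halts x fx≡0 = 0 , evMin (evComp (evProj ∷ [])
                    (subst (Eval c (x ∷ [])) (isZero-sound _ fx≡0) (ec x))) (λ _ ())
  halted : ∀ x → (∃ λ y → Eval search (x ∷ []) y) → x ∈ Zeros f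
  halted x (_ , evMin (evComp (evProj ∷ []) e) _)
    rewrite eval-deterministic (ec x) e = refl

_∪_ : Subset → Subset → Subset
(X ∪ Y) x = X x ∨ Y x

∅ : Subset
∅ _ = false

⋃ : List Subset → Subset
⋃ []       = ∅
⋃ (X ∷ Xs) = X ∪ ⋃ Xs

below : ℕ → Subset
below B y = y <ᵇ B

_⊆_ : Subset → Subset → Set
X ⊆ Y = ∀ x → x ∈ X → x ∈ Y

_⊆*_ : Subset → Subset → Set
X ⊆* Y = ∃ λ b → ∀ x → x ∈ X → b ≤ x → x ∈ Y

∈-⋃ : ∀ {x} Xs → Any (x ∈_) Xs → x ∈ ⋃ Xs
∈-⋃ (X ∷ Xs) (here x∈X)  = cong (_∨ ⋃ Xs _) x∈X
∈-⋃ (X ∷ Xs) (there x∈⋃) = trans (cong (X _ ∨_) (∈-⋃ Xs x∈⋃)) (∨-zeroʳ (X _))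

∈-complement⇒∉ : ∀ {x} X → x ∈ complement X → x ∉ X
∈-complement⇒∉ {x} X x∈∁X with X x
... | false = refl

finite-∩⇒⊆*-complement : ∀ {X Y} → Finite (X ∩ Y) → X ⊆* complement Y
finite-∩⇒⊆*-complement {X} {Y} (b , fin) = b , outside
  where
  outside : ∀ x → x ∈ X → b ≤ x → x ∈ complement Y
  outside x x∈X b≤x with Y x in x∈Y
  ... | false = refl
  ... | true  = ⊥-elim (<⇒≱ (fin x (cong₂ Data.Bool._∧_ x∈X x∈Y)) b≤x)

count-∉ : ∀ {X n} → n ∉ X → count X (suc n) ≡ count X n
count-∉ n∉X rewrite n∉X = refl

count-≤ : ∀ X n → count X n ≤ n
count-≤ X zero = z≤n
count-≤ X (suc n) with X n
... | true  = s≤s (count-≤ X n)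
... | false = m≤n⇒m≤1+n (count-≤ X n)

count-mono : ∀ {X Y} → X ⊆ Y → ∀ n → count X n ≤ count Y n
count-mono h zero = z≤n
count-mono {X} {Y} h (suc n) with X n in x∈X | Y n in y∈Y
... | true  | true  = s≤s (count-mono h n)
... | false | true  = m≤n⇒m≤1+n (count-mono h n)
... | false | false = count-mono h n
... | true  | false = ⊥-elim (false≢true (trans (sym y∈Y) (h n x∈X)))

count-∪ : ∀ X Y n → count (X ∪ Y) n ≤ count X n + count Y n
count-∪ X Y zero = z≤n
count-∪ X Y (suc n) with X n | Y n
... | true  | true  = s≤s (≤-trans (count-∪ X Y n) (+-monoʳ-≤ (count X n) (n≤1+n _)))
... | true  | false = s≤s (count-∪ X Y n)
... | false | true  = ≤-trans (s≤s (count-∪ X Y n)) (≤-reflexive (sym (+-suc _ _)))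
... | false | false = count-∪ X Y n

count-below : ∀ B n → count (below B) n ≤ B
count-below B zero = z≤n
count-below B (suc n) with n <ᵇ B in n<B
... | false = count-below B n
... | true  = ≤-trans (s≤s (count-≤ (below B) n)) (<ᵇ⇒< n B (Equivalence.from T-≡ n<B))

count-∅ : ∀ n → count ∅ n ≡ 0
count-∅ zero    = refl
count-∅ (suc n) = count-∅ n

-- X has upper density at most d/M: M·|X ∩ [0, n)| ≤ d·n + B for a fixed B.
record DensityBound (M d : ℕ) (X : Subset) : Set where
  constructor bounded-by
  field
    error : ℕ
    bound : ∀ n → M * count X n ≤ d * n + error

density-⊆ : ∀ {M d X Y} → X ⊆ Y → DensityBound M d Y → DensityBound M d X
density-⊆ {M} X⊆Y (bounded-by B h) = bounded-by B λ n → ≤-trans (*-monoʳ-≤ M (count-mono X⊆Y n)) (h n)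

density-∪ : ∀ {M d e X Y} → DensityBound M d X → DensityBound M e Y →
            DensityBound M (d + e) (X ∪ Y)
density-∪ {M} {d} {e} {X} {Y} (bounded-by B₁ h₁) (bounded-by B₂ h₂) = bounded-by (B₁ + B₂) λ n → begin
  M * count (X ∪ Y) n             ≤⟨ *-monoʳ-≤ M (count-∪ X Y n) ⟩
  M * (count X n + count Y n)     ≡⟨ *-distribˡ-+ M (count X n) (count Y n) ⟩
  M * count X n + M * count Y n   ≤⟨ +-mono-≤ (h₁ n) (h₂ n) ⟩
  (d * n + B₁) + (e * n + B₂)     ≡⟨ interchange +-commutativeSemigroup (d * n) B₁ (e * n) B₂ ⟩
  (d * n + e * n) + (B₁ + B₂)     ≡⟨ cong (_+ (B₁ + B₂)) (sym (*-distribʳ-+ n d e)) ⟩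
  (d + e) * n + (B₁ + B₂)         ∎
  where open ≤-Reasoning

density-below : ∀ {M} B → DensityBound M 0 (below B)
density-below {M} B = bounded-by (M * B) λ n → *-monoʳ-≤ M (count-below B n)

density-⊆* : ∀ {M d X Y} → X ⊆* Y → DensityBound M d Y → DensityBound M d X
density-⊆* {X = X} {Y} (b , almost) dY = density-⊆ split (density-∪ (density-below b) dY)
  where
  split : X ⊆ (below b ∪ Y)
  split x x∈X with x <? b
  ... | yes x<b = cong (_∨ Y x) (Equivalence.to T-≡ (<⇒<ᵇ x<b))
  ... | no  x≮b = trans (cong (below b x ∨_) (almost x x∈X (≮⇒≥ x≮b))) (∨-zeroʳ _)

density-⋃ : ∀ {M} Xs → All (DensityBound M 1) Xs → DensityBound M (length Xs) (⋃ Xs)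
density-⋃ {M} [] All.[] = bounded-by 0 λ n → ≤-reflexive (trans (cong (M *_) (count-∅ n)) (*-zeroʳ M))
density-⋃ (X ∷ Xs) (dX All.∷ dXs) = density-∪ dX (density-⋃ Xs dXs)

Sparse : ℕ → Subset → Set
Sparse M P = ∀ y j → y ∈ P → 0 < j → j < M → (y + j) ∉ P

module _ {P : Subset} {M : ℕ} (sparse : Sparse M P) where

  sparse-before : ∀ n d → (n + d) ∈ P → d < M → ∀ j → j < d → (n + j) ∉ P
  sparse-before n d n+d∈P d<M j j<d with P (n + j) in n+j∈P
  ... | false = refl
  ... | true  = ⊥-elim (false≢true (trans (sym (subst (_∉ P) reach far)) n+d∈P))
    where
    far : (n + j + (d ∸ j)) ∉ P
    far = sparse (n + j) (d ∸ j) n+j∈P (m<n⇒0<n∸m j<d) (≤-<-trans (m∸n≤m d j) d<M)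
    reach : n + j + (d ∸ j) ≡ n + d
    reach = trans (+-assoc n j (d ∸ j)) (cong (n +_) (m+[n∸m]≡n (<⇒≤ j<d)))

  count-gap : ∀ n d → (∀ j → j < d → (n + j) ∉ P) → count P (n + d) ≡ count P n
  count-gap n zero _ = cong (count P) (+-identityʳ n)
  count-gap n (suc d) gap = begin
    count P (n + suc d)   ≡⟨ cong (count P) (+-suc n d) ⟩
    count P (suc (n + d)) ≡⟨ count-∉ {P} (gap d (n<1+n d)) ⟩
    count P (n + d)       ≡⟨ count-gap n d (λ j j<d → gap j (m<n⇒m<1+n j<d)) ⟩
    count P n             ∎
    where open ≡-Reasoning

  window : ∀ n d → d ≤ M → count P (n + d) ≤ suc (count P n)
  window n zero _ = ≤-trans (≤-reflexive (cong (count P) (+-identityʳ n))) (n≤1+n _)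
  window n (suc d) d<M rewrite +-suc n d with P (n + d) in n+d∈P
  ... | false = window n d (<⇒≤ d<M)
  ... | true  = s≤s (≤-reflexive (count-gap n d (sparse-before n d n+d∈P d<M)))

  sparse-count : .{{NonZero M}} → ∀ n → M * count P n ≤ n + M
  sparse-count = <-rec _ bound
    where
    open ≤-Reasoning
    bound : ∀ n → (∀ {k} → k < n → M * count P k ≤ k + M) → M * count P n ≤ n + M
    bound n rec with n <? M
    ... | yes n<M = begin
      M * count P n           ≤⟨ *-monoʳ-≤ M (window 0 n (<⇒≤ n<M)) ⟩
      M * 1                   ≡⟨ *-identityʳ M ⟩
      M                       ≤⟨ m≤n+m M n ⟩
      n + M                   ∎
    ... | no n≮M = begin
      M * count P n           ≡⟨ cong (λ z → M * count P z) (sym k+M≡n) ⟩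
      M * count P (k + M)     ≤⟨ *-monoʳ-≤ M (window k M ≤-refl) ⟩
      M * suc (count P k)     ≡⟨ *-suc M (count P k) ⟩
      M + M * count P k       ≤⟨ +-monoʳ-≤ M (rec k<n) ⟩
      M + (k + M)             ≡⟨ +-comm M (k + M) ⟩
      k + M + M               ≡⟨ cong (_+ M) k+M≡n ⟩
      n + M                   ∎
      where
      k = n ∸ M
      k+M≡n : k + M ≡ n
      k+M≡n = m∸n+n≡m (≮⇒≥ n≮M)
      k<n : k < n
      k<n = subst (k <_) k+M≡n (m<m+n k (>-nonZero⁻¹ M))

  density-sparse : .{{NonZero M}} → DensityBound M 1 P
  density-sparse = bounded-by M λ n → subst (λ z → M * count P n ≤ z + M) (sym (*-identityˡ n)) (sparse-count n)

cpred : ℕ → ℕ → ℕ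
cpred A zero    = A
cpred A (suc r) = r

-- Walking n steps down the cycle from A: cycle A n ≡ (A - n) mod (A + 1).
cycle : ℕ → ℕ → ℕ
cycle A = fold A (cpred A)

computable-cycle : ∀ A → Computable (cycle A)
computable-cycle A = computable-fold A (recᶜ (constᶜ A) (projᶜ fzero) , eval)
  where
  eval : ∀ r → Eval (recᶜ (constᶜ A) (projᶜ fzero)) (r ∷ []) (cpred A r)
  eval zero    = evRec0 (eval-const A)
  eval (suc r) = evRecS (eval r) evProj

cycle-+ : ∀ A j n → cycle A (j + n) ≡ fold (cycle A n) (cpred A) j
cycle-+ A j n = fold-+ A (cpred A) j

cycle-≤ : ∀ A n → cycle A n ≤ A
cycle-≤ A zero = ≤-refl
cycle-≤ A (suc n) with cycle A n | cycle-≤ A n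
... | zero  | _     = ≤-refl
... | suc r | r+1≤A = ≤-trans (n≤1+n r) r+1≤A

cpred-self : ∀ A r → iterate (cpred A) r r ≡ 0
cpred-self A zero    = refl
cpred-self A (suc r) = cpred-self A r

cpred-down : ∀ A {a} j → j ≤ a → iterate (cpred A) a j ≡ a ∸ j
cpred-down A {a}     zero    _         = refl
cpred-down A {suc a} (suc j) (s≤s j≤a) = cpred-down A j j≤a

-- Slice A v = { y : v + y ≡ A (mod A + 1) }.
Slice : ℕ → ℕ → Subset
Slice A v = Zeros (cycle A ∘ (v +_))

slice-cover : ∀ A y → ∃ λ v → v < suc A × y ∈ Slice A v
slice-cover A y = cycle A y , s≤s (cycle-≤ A y) , cong isZero reach
  where
  r = cycle A y
  reach : cycle A (r + y) ≡ 0
  reach = trans (cycle-+ A r y) (trans (iterate-is-fold r (cpred A) r) (cpred-self A r))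

-- From an element of a slice, the next A steps land on the nonzero
-- positions A, A - 1, …, 1 of the cycle; so slices are (A + 1)-sparse.
slice-sparse : ∀ A v → Sparse (suc A) (Slice A v)
slice-sparse A v y (suc i) y∈S _ (s≤s i<A) = trans (cong isZero ahead) (isZero-pos (m<n⇒0<n∸m i<A))
  where
  open ≡-Reasoning
  ahead : cycle A (v + (y + suc i)) ≡ A ∸ i
  ahead = begin
    cycle A (v + (y + suc i))                 ≡⟨ cong (cycle A) (trans (sym (+-assoc v y (suc i))) (+-comm (v + y) (suc i))) ⟩
    cycle A (suc i + (v + y))                 ≡⟨ cycle-+ A (suc i) (v + y) ⟩
    fold (cycle A (v + y)) (cpred A) (suc i)  ≡⟨ cong (λ r → fold r (cpred A) (suc i)) (isZero-sound _ y∈S) ⟩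
    fold 0 (cpred A) (suc i)                  ≡⟨ iterate-is-fold 0 (cpred A) (suc i) ⟩
    iterate (cpred A) A i                     ≡⟨ cpred-down A i (<⇒≤ i<A) ⟩
    A ∸ i                                     ∎

module _ {C : Subset} (cohesive : Cohesive C) (U : ℕ → Subset) (ce : ∀ v → IsCE (U v)) where

  cohesive-dichotomy : ∀ k → (∃ λ v → C ⊆* U v)
                           ⊎ (∃ λ b → ∀ x → x ∈ C → b ≤ x → ∀ v → v < k → x ∉ U v)
  cohesive-dichotomy zero = inj₂ (0 , λ _ _ _ _ ())
  cohesive-dichotomy (suc k) with proj₂ cohesive (U k) (ce k) | cohesive-dichotomy k
  ... | inj₂ C∖Uk-finite | _ =
    let (b , inside) = finite-∩⇒⊆*-complement C∖Uk-finite
    in inj₁ (k , b , λ x x∈C b≤x → trans (sym (not-involutive _)) (inside x x∈C b≤x))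
  ... | inj₁ _ | inj₁ found = inj₁ found
  ... | inj₁ C∩Uk-finite | inj₂ (b , avoid)
    with b′ , outside ← finite-∩⇒⊆*-complement {C} {U k} C∩Uk-finite = inj₂ (b ⊔ b′ , avoid′)
    where
    avoid′ : ∀ x → x ∈ C → b ⊔ b′ ≤ x → ∀ v → v < suc k → x ∉ U v
    avoid′ x x∈C le v v<k+1 with m<1+n⇒m<n∨m≡n v<k+1
    ... | inj₁ v<k  = avoid x x∈C (≤-trans (m≤m⊔n b b′) le) v v<k
    ... | inj₂ refl = ∈-complement⇒∉ (U v) (outside x x∈C (≤-trans (m≤n⊔m b b′) le))

  cohesive-in-cover : ∀ k → (∀ x → ∃ λ v → v < k × x ∈ U v) → ∃ λ v → C ⊆* U v
  cohesive-in-cover k cover with cohesive-dichotomy k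
  ... | inj₁ found = found
  ... | inj₂ (b , avoid) with proj₁ cohesive b
  ... | x , b≤x , x∈C with cover x
  ... | v , v<k , x∈Uv = ⊥-elim (false≢true (trans (sym (avoid x x∈C b≤x v v<k)) x∈Uv))

preimage : ℕ ↔ ℕ → Subset → Subset
preimage π P x = P (Inverse.to π x)

bounded-on : (f : ℕ → ℕ) (b : ℕ) → ∃ λ B → ∀ x → x < b → f x < B
bounded-on f zero = 0 , λ _ ()
bounded-on f (suc b) with bounded-on f b
... | B , bounded = B ⊔ suc (f b) , bounded′
  where
  bounded′ : ∀ x → x < suc b → f x < B ⊔ suc (f b)
  bounded′ x x<b+1 with m<1+n⇒m<n∨m≡n x<b+1
  ... | inj₁ x<b  = ≤-trans (bounded x x<b) (m≤m⊔n B _)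
  ... | inj₂ refl = m≤n⊔m B (suc (f x))

-- Almost-inclusion is transported by a permutation: the finitely many
-- exceptions below b are sent below the bound B of π on [0, b).
image-⊆* : ∀ π {C P} → C ⊆* preimage π P → image π C ⊆* P
image-⊆* π {C} {P} (b , almost) with bounded-on (Inverse.to π) b
... | B , bounded = B , λ y y∈πC B≤y →
  subst (_∈ P) (Inverse.strictlyInverseˡ π y) (almost (from y) y∈πC (far y B≤y))
  where
  from = Inverse.from π
  far : ∀ y → B ≤ y → b ≤ from y
  far y B≤y with from y <? b
  ... | no  ≮b = ≮⇒≥ ≮b
  ... | yes <b = ⊥-elim (<⇒≱ (subst (_< B) (Inverse.strictlyInverseˡ π y) (bounded (from y) <b)) B≤y)

cohesive-image-density : ∀ {C} → Cohesive C → (π : ℕ ↔ ℕ) → ComputablePerm π →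
                         ∀ A → DensityBound (suc A) 1 (image π C)
cohesive-image-density {C} coh π computable A with cohesive-in-cover coh U U-ce (suc A) cover
  where
  U : ℕ → Subset
  U v = preimage π (Slice A v)
  U-ce : ∀ v → IsCE (U v)
  U-ce v = zeros-ce (computable-∘ (computable-∘ (computable-cycle A) (computable-+ v)) computable)
  cover : ∀ x → ∃ λ v → v < suc A × x ∈ U v
  cover x = slice-cover A (Inverse.to π x)
... | v , C⊆*U = density-⊆* (image-⊆* π {C} {Slice A v} C⊆*U) (density-sparse (slice-sparse A v))

density-eventually : ∀ K m X → DensityBound (K * suc m) m X →
                     ∃ λ N → ∀ n → N ≤ n → K * count X n ≤ n
density-eventually K m X (bounded-by B h) = B , λ n B≤n → *-cancelˡ-≤ (suc m) (begin
  suc m * (K * count X n) ≡⟨ sym (*-assoc (suc m) K _) ⟩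
  suc m * K * count X n   ≡⟨ cong (_* count X n) (*-comm (suc m) K) ⟩
  K * suc m * count X n   ≤⟨ h n ⟩
  m * n + B               ≤⟨ +-monoʳ-≤ (m * n) B≤n ⟩
  m * n + n               ≡⟨ +-comm (m * n) n ⟩
  suc m * n               ∎)
  where open ≤-Reasoning

mainTheorem13 : (Q : Subset) → QuasiCohesive Q → IntrinsicDensityZero Q
mainTheorem13 Q _ π _ zero = 0 , λ _ _ → z≤n
mainTheorem13 Q (Cs , cohesive , Q≡⋃Cs) π computable (suc K) =
  density-eventually (suc K) m (image π Q) (density-⊆ πQ⊆⋃ density-⋃πCs)
  where
  m = length Cs
  πCs = map (image π) Cs
  -- each π(C) has density at most 1/M, where M = (K + 1)(m + 1)
  M = suc K * suc m
  density-⋃πCs : DensityBound M m (⋃ πCs)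
  density-⋃πCs = subst (λ d → DensityBound M d (⋃ πCs)) (length-map (image π) Cs)
    (density-⋃ πCs (All.map⁺
      (All.map (λ c → cohesive-image-density c π computable (m + K * suc m)) cohesive)))
  πQ⊆⋃ : image π Q ⊆ ⋃ πCs
  πQ⊆⋃ y y∈πQ = ∈-⋃ πCs (Any.map⁺ (proj₁ (Q≡⋃Cs (Inverse.from π y)) y∈πQ))
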